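{- Let $F$ be an instance of IECMV($p$) with $p$ a fixed constant, let $s_1,\dots,s_k$ be the sets produced (in this order) by the greedy algorithm on $F$, and let $S=\{s_1,\dots,s_k\}$. Let $\mathrm{Opt}$ be an optimal solution of IECMV($p$) on $F$. Define $P(\mathrm{Opt},1)=P(\mathrm{Opt},s_1)$ and, for $1\le i\le k$, $P(\mathrm{Opt},i)=P(\mathrm{Opt},s_i)\setminus\bigcup_{1\le j<i}P(\mathrm{Opt},j)$. Then $|P(\mathrm{Opt},i)|\le 2|P(s_i)|$ for every $1\le i\le k$.
   Context: A fingerprint of length $l$ is a vector in $\{0,1,N\}^l$. Two fingerprints $v_1,v_2$ are compatible if for every position $i$ with $v_1[i]\ne v_2[i]$, at least one of $v_1[i],v_2[i]$ equals $N$. A resolution of a fingerprint $v$ is a vector $r\in\{0,1\}^l$ with $r[i]=v[i]$ whenever $v[i]\ne N$. An instance of IECMV($p$) is a finite set $F$ of fingerprints of the same length, each with at most $p$ entries equal to $N$; a feasible solution is a partition of $F$ into sets of pairwise compatible fingerprints; the objective is to maximize the number of unordered pairs of distinct fingerprints lying in a common set of the partition. Greedy algorithm: let $R$ be the set of all $r\in\{0,1\}^l$ that are resolutions of at least one fingerprint of $F$; set $U:=F$; while $U\neq\emptyset$, choose $r\in R$ maximizing the number of fingerprints in $U$ of which $r$ is a resolution, let $s$ be the set of those fingerprints, output $s$ as the next set, and set $U:=U\setminus s$. For a set $s$ of fingerprints, $P(s)$ is the set of unordered pairs of distinct elements of $s$. For a partition $Q$, $P(Q)=\bigcup_{q\in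 Q}P(q)$, and for $W\subseteq F$, $P(Q,W)$ is the set of pairs $\{x,y\}\in P(Q)$ with at least one of $x,y$ in $W$. -}

module Defs where

open import Data.Bool using (Bool; true; false; _∧_; _∨_; not; if_then_else_)
open import Data.Nat using (ℕ; zero; suc; _+_; _≡ᵇ_; _≤_)
open import Data.Fin using (Fin; toℕ; _<?_)
import Data.Fin as Fin
open import Data.Vec using (Vec; []; _∷_)
open import Data.List using (List; []; _∷_)
open import Data.Product using (∃; _×_)
open import Relation.Binary.PropositionalEquality using (_≡_)
open import Relation.Nullary.Decidable using (⌊_⌋)

data Sym : Set where
  𝟘 𝟙 N : Sym

Fingerprint : ℕ → Set
Fingerprint l = Vec Sym l

countN : ∀ {l} → Fingerprint l → ℕ
countN [] = 0
countN (N ∷ v) = suc (countN v)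
countN (𝟘 ∷ v) = countN v
countN (𝟙 ∷ v) = countN v

compatSym : Sym → Sym → Bool
compatSym N _ = true
compatSym _ N = true
compatSym 𝟘 𝟘 = true
compatSym 𝟙 𝟙 = true
compatSym _ _ = false

compatible : ∀ {l} → Fingerprint l → Fingerprint l → Bool
compatible [] [] = true
compatible (a ∷ v) (b ∷ w) = compatSym a b ∧ compatible v w

resolvesSym : Bool → Sym → Bool
resolvesSym _ N = true
resolvesSym false 𝟘 = true
resolvesSym true 𝟙 = true
resolvesSym _ _ = false

isResolution : ∀ {l} → Vec Bool l → Fingerprint l → Bool
isResolution [] [] = true
isResolution (b ∷ r) (s ∷ v) = resolvesSym b s ∧ isResolution r v

Subset : ℕ → Set
Subset n = Fin n → Bool

card : ∀ {n} → Subset n → ℕ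
card {zero} s = 0
card {suc n} s = (if s Fin.zero then 1 else 0) + card (λ x → s (Fin.suc x))

PairPred : ℕ → Set
PairPred n = Fin n → Fin n → Bool

-- number of unordered pairs {a,b}, a ≠ b, satisfying a symmetric predicate Q
-- (each unordered pair counted once via its representative with a < b)
sumFin : ∀ {n} → (Fin n → ℕ) → ℕ
sumFin {zero} f = 0
sumFin {suc n} f = f Fin.zero + sumFin (λ x → f (Fin.suc x))

countPairs : ∀ {n} → PairPred n → ℕ
countPairs Q = sumFin (λ a → card (λ b → ⌊ a <? b ⌋ ∧ Q a b))

-- IECMV(p) instances, given as an injective family F : Fin n → Fingerprint l
-- (injective = F is a *set* of fingerprints)

module _ {n l : ℕ} (F : Fin n → Fingerprint l) where

  InR : Vec Bool l → Set
  InR r = ∃ λ x → isResolution r (F x) ≡ true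

  -- A partition of F, given by a block label for each fingerprint
  -- (x and y lie in the same set of the partition iff c x ≡ c y).
  Labelling : Set
  Labelling = Fin n → ℕ

  Feasible : Labelling → Set
  Feasible c = ∀ x y → c x ≡ c y → compatible (F x) (F y) ≡ true

  PQ : Labelling → PairPred n
  PQ c x y = c x ≡ᵇ c y

  Optimal : Labelling → Set
  Optimal c = Feasible c × (∀ c′ → Feasible c′ → countPairs (PQ c′) ≤ countPairs (PQ c))

  hit : Subset n → Vec Bool l → Subset n
  hit U r x = U x ∧ isResolution r (F x)

  -- GreedyFrom U ss : ss is a possible output sequence of the greedy
  -- algorithm's while-loop started with current set U (any tie-breaking)
  data GreedyFrom (U : Subset n) : List (Subset n) → Set where
    done : (∀ x → U x ≡ false) → GreedyFrom U []
    step : ∀ {ss} (r : Vec Bool l) → InR r →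
           (∃ λ x → U x ≡ true) →
           (∀ r′ → InR r′ → card (hit U r′) ≤ card (hit U r)) →
           GreedyFrom (λ x → U x ∧ not (hit U r x)) ss →
           GreedyFrom U (hit U r ∷ ss)

  GreedyRun : List (Subset n) → Set
  GreedyRun ss = GreedyFrom (λ _ → true) ss

module _ {n : ℕ} where

  Pset : Subset n → PairPred n
  Pset s x y = s x ∧ s y

  PQW : (Fin n → ℕ) → Subset n → PairPred n
  PQW c W x y = (c x ≡ᵇ c y) ∧ (W x ∨ W y)

  -- the (0-based) i-th set of a list, empty outside the range
  seqAt : List (Subset n) → ℕ → Subset n
  seqAt [] _ = λ _ → false
  seqAt (s ∷ ss) zero = s
  seqAt (s ∷ ss) (suc i) = seqAt ss i

  -- POpt c ss i  = P(Opt, i+1)  (0-based index i),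
  -- POptBefore c ss i = ⋃_{j < i} POpt c ss j
  mutual
    POpt : (Fin n → ℕ) → List (Subset n) → ℕ → PairPred n
    POpt c ss i x y = PQW c (seqAt ss i) x y ∧ not (POptBefore c ss i x y)

    POptBefore : (Fin n → ℕ) → List (Subset n) → ℕ → PairPred n
    POptBefore c ss zero x y = false
    POptBefore c ss (suc i) x y = POptBefore c ss i x y ∨ POpt c ss i x y

module Submission where

-- Fix the step k at which the greedy algorithm outputs s = s_k = hit U r, U being the set of
-- fingerprints not yet covered. A pair {a, b} of P(Opt, k) lies in one set of Opt and has an
-- endpoint in s; neither endpoint lies in an earlier s_j, for otherwise the pair would belong to
-- an earlier P(Opt, j), so both lie in U. Orient the pair as (a, b) with a ∈ s. For fixed a, the
-- set of Opt containing a is pairwise compatible, hence has a common resolution r′, so it meets U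
-- in at most |hit U r′| ≤ |hit U r| = |s| fingerprints. This gives at most |s|² ordered pairs, |s|
-- of which are the diagonal pairs (a, a); hence |P(Opt, k)| ≤ |s|² - |s| = 2 |P(s)|.

open import Defs
open import Data.Nat using (ℕ; _≤_; _*_)
open import Data.Fin using (Fin; toℕ)
open import Data.Vec using (Vec)
open import Data.List using (List; length; lookup)
open import Function.Definitions using (Injective)
open import Relation.Binary.PropositionalEquality using (_≡_)

open import Data.Bool using (Bool; true; false; _∧_; _∨_; not; if_then_else_)
open import Data.Bool.Properties
  using (∧-conicalˡ; ∧-conicalʳ; ∨-conicalˡ; ∨-conicalʳ; ∨-zeroʳ; ∧-distribˡ-∨; ∧-comm;
         ¬-not; not-¬; not-injective; T-≡)
  renaming (_≟_ to _≟ᵇ_)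
open import Data.Empty using (⊥-elim)
open import Data.Fin using (zero; suc; _<?_; _≟_)
open import Data.Fin.Properties using (<-cmp; any?)
open import Data.List using (_∷_)
open import Data.Nat using (zero; suc; _+_; _<_; _≡ᵇ_; z≤n; s≤s; z<s; s<s)
open import Data.Nat.Properties
  using (+-0-commutativeMonoid; +-identityʳ; +-mono-≤; +-monoˡ-≤; +-monoʳ-≤; +-cancelʳ-≤;
         ≤-refl; ≤-trans; ≤-reflexive; m<1+n⇒m<n∨m≡n; ≡ᵇ⇒≡; ≡⇒≡ᵇ; module ≤-Reasoning)
open import Data.Product using (∃; _×_; _,_; proj₁; proj₂)
open import Data.Sum using (_⊎_; inj₁; inj₂; [_,_]′)
open import Data.Vec using ([]; _∷_; head; tail)
open import Function using (flip; _∘_; Equivalence)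
open import Relation.Binary.Definitions using (tri<; tri≈; tri>)
open import Relation.Binary.PropositionalEquality
  using (_≢_; refl; sym; trans; cong; cong₂; subst; module ≡-Reasoning)
open import Relation.Nullary.Decidable
  using (Dec; yes; no; ⌊_⌋; does; isYes≗does; dec-true; dec-false; _×-dec_)
open import Algebra.Properties.CommutativeMonoid.Sum +-0-commutativeMonoid
  using (sum; sum-syntax; sum-cong-≗; ∑-distrib-+; ∑-comm)

⟦_⟧ : Bool → ℕ
⟦ b ⟧ = if b then 1 else 0

sumFin≡sum : ∀ {n} (f : Fin n → ℕ) → sumFin f ≡ sum f
sumFin≡sum {zero} f = refl
sumFin≡sum {suc n} f = cong (f zero +_) (sumFin≡sum (f ∘ suc))

card≡∑ : ∀ {n} (t : Subset n) → card t ≡ ∑[ x < n ] ⟦ t x ⟧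
card≡∑ {zero} t = refl
card≡∑ {suc n} t = cong (⟦ t zero ⟧ +_) (card≡∑ (t ∘ suc))

∑-mono-≤ : ∀ {n} {f g : Fin n → ℕ} → (∀ i → f i ≤ g i) → sum f ≤ sum g
∑-mono-≤ {zero} f≤g = z≤n
∑-mono-≤ {suc n} f≤g = +-mono-≤ (f≤g zero) (∑-mono-≤ (f≤g ∘ suc))

card-∅ : ∀ {n} → card {n} (λ _ → false) ≡ 0
card-∅ {zero} = refl
card-∅ {suc n} = card-∅ {n}

card-mono : ∀ {n} {t u : Subset n} → (∀ x → t x ≡ true → u x ≡ true) → card t ≤ card u
card-mono {zero} t⊆u = z≤n
card-mono {suc n} {t} {u} t⊆u = +-mono-≤ (⟦⟧-mono (t zero) (u zero) (t⊆u zero)) (card-mono (t⊆u ∘ suc))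
  where
  ⟦⟧-mono : ∀ x y → (x ≡ true → y ≡ true) → ⟦ x ⟧ ≤ ⟦ y ⟧
  ⟦⟧-mono false y _ = z≤n
  ⟦⟧-mono true y x⇒y rewrite x⇒y refl = ≤-refl

card-cong : ∀ {n} {t u : Subset n} → (∀ x → t x ≡ u x) → card t ≡ card u
card-cong {t = t} {u} t≗u = trans (card≡∑ t) (trans (sum-cong-≗ (cong ⟦_⟧ ∘ t≗u)) (sym (card≡∑ u)))

card-∨≤ : ∀ {n} (t u : Subset n) → card (λ x → t x ∨ u x) ≤ card t + card u
card-∨≤ {n} t u = begin
  card (λ x → t x ∨ u x)                ≡⟨ card≡∑ (λ x → t x ∨ u x) ⟩
  ∑[ x < n ] ⟦ t x ∨ u x ⟧              ≤⟨ ∑-mono-≤ (λ x → ⟦∨⟧≤ (t x) (u x)) ⟩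
  ∑[ x < n ] (⟦ t x ⟧ + ⟦ u x ⟧)        ≡⟨ ∑-distrib-+ (⟦_⟧ ∘ t) (⟦_⟧ ∘ u) ⟩
  ∑[ x < n ] ⟦ t x ⟧ + ∑[ x < n ] ⟦ u x ⟧ ≡⟨ sym (cong₂ _+_ (card≡∑ t) (card≡∑ u)) ⟩
  card t + card u                       ∎
  where
  open ≤-Reasoning
  ⟦∨⟧≤ : ∀ x y → ⟦ x ∨ y ⟧ ≤ ⟦ x ⟧ + ⟦ y ⟧
  ⟦∨⟧≤ true y = s≤s z≤n
  ⟦∨⟧≤ false y = ≤-refl

card-∧ˡ-mono : ∀ {n} x {t u : Subset n} → (x ≡ true → card t ≤ card u) →
               card (λ b → x ∧ t b) ≤ card (λ b → x ∧ u b)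
card-∧ˡ-mono true  bound = bound refl
card-∧ˡ-mono false {t} _ = card-mono {t = λ b → false ∧ t b} (λ _ ())

-- `does` rather than ⌊_⌋ (= isYes): only `does` computes through the map′ in suc a ≟ suc b.
card-≟ : ∀ {n} (a : Fin n) (t : Subset n) → card (λ b → does (a ≟ b) ∧ t b) ≡ ⟦ t a ⟧
card-≟ {suc n} zero    t = trans (cong (⟦ t zero ⟧ +_) (card-∅ {n})) (+-identityʳ _)
card-≟ {suc n} (suc a) t = card-≟ a (t ∘ suc)

⟦⟧-trichotomy : ∀ {n} (a b : Fin n) x →
                ⟦ x ⟧ ≡ ⟦ ⌊ a <? b ⌋ ∧ x ⟧ + ⟦ ⌊ b <? a ⌋ ∧ x ⟧ + ⟦ does (a ≟ b) ∧ x ⟧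
⟦⟧-trichotomy a b x rewrite isYes≗does (a <? b) | isYes≗does (b <? a) with <-cmp a b
... | tri< a<b a≢b b≮a rewrite dec-true (a <? b) a<b | dec-false (b <? a) b≮a | dec-false (a ≟ b) a≢b
  = sym (trans (+-identityʳ _) (+-identityʳ _))
... | tri≈ a≮b a≡b b≮a rewrite dec-false (a <? b) a≮b | dec-false (b <? a) b≮a | dec-true (a ≟ b) a≡b
  = refl
... | tri> a≮b a≢b b<a rewrite dec-false (a <? b) a≮b | dec-true (b <? a) b<a | dec-false (a ≟ b) a≢b
  = sym (+-identityʳ _)

card-split-at : ∀ {n} (a : Fin n) (t : Subset n) →
                card t ≡ card (λ b → ⌊ a <? b ⌋ ∧ t b) + card (λ b → ⌊ b <? a ⌋ ∧ t b) + ⟦ t a ⟧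
card-split-at {n} a t = begin
  card t
    ≡⟨ card≡∑ t ⟩
  ∑[ b < n ] ⟦ t b ⟧
    ≡⟨ sum-cong-≗ (λ b → ⟦⟧-trichotomy a b (t b)) ⟩
  ∑[ b < n ] (⟦ above b ⟧ + ⟦ below b ⟧ + ⟦ at b ⟧)
    ≡⟨ ∑-distrib-+ (λ b → ⟦ above b ⟧ + ⟦ below b ⟧) (⟦_⟧ ∘ at) ⟩
  ∑[ b < n ] (⟦ above b ⟧ + ⟦ below b ⟧) + ∑[ b < n ] ⟦ at b ⟧
    ≡⟨ cong (_+ ∑[ b < n ] ⟦ at b ⟧) (∑-distrib-+ (⟦_⟧ ∘ above) (⟦_⟧ ∘ below)) ⟩
  ∑[ b < n ] ⟦ above b ⟧ + ∑[ b < n ] ⟦ below b ⟧ + ∑[ b < n ] ⟦ at b ⟧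
    ≡⟨ sym (cong₂ _+_ (cong₂ _+_ (card≡∑ above) (card≡∑ below)) (card≡∑ at)) ⟩
  card above + card below + card at
    ≡⟨ cong (card above + card below +_) (card-≟ a t) ⟩
  card above + card below + ⟦ t a ⟧ ∎
  where
  open ≡-Reasoning
  above below at : Subset n
  above b = ⌊ a <? b ⌋ ∧ t b
  below b = ⌊ b <? a ⌋ ∧ t b
  at    b = does (a ≟ b) ∧ t b

orderedPairs : ∀ {n} → PairPred n → ℕ
orderedPairs {n} Q = ∑[ a < n ] card (Q a)

countPairs≡orderedPairs : ∀ {n} (Q : PairPred n) →
                          countPairs Q ≡ orderedPairs (λ a b → ⌊ a <? b ⌋ ∧ Q a b)
countPairs≡orderedPairs Q = sumFin≡sum (λ a → card (λ b → ⌊ a <? b ⌋ ∧ Q a b))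

orderedPairs-mono : ∀ {n} {Q R : PairPred n} → (∀ a b → Q a b ≡ true → R a b ≡ true) →
                    orderedPairs Q ≤ orderedPairs R
orderedPairs-mono Q⊆R = ∑-mono-≤ (λ a → card-mono (Q⊆R a))

orderedPairs-∨ : ∀ {n} (Q R : PairPred n) →
                 orderedPairs (λ a b → Q a b ∨ R a b) ≤ orderedPairs Q + orderedPairs R
orderedPairs-∨ Q R =
  ≤-trans (∑-mono-≤ (λ a → card-∨≤ (Q a) (R a))) (≤-reflexive (∑-distrib-+ (card ∘ Q) (card ∘ R)))

orderedPairs-flip : ∀ {n} (Q : PairPred n) → orderedPairs (flip Q) ≡ orderedPairs Q
orderedPairs-flip {n} Q = begin
  ∑[ a < n ] card (λ b → Q b a)         ≡⟨ sum-cong-≗ (λ a → card≡∑ (λ b → Q b a)) ⟩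
  ∑[ a < n ] ∑[ b < n ] ⟦ Q b a ⟧        ≡⟨ ∑-comm (λ a b → ⟦ Q b a ⟧) ⟩
  ∑[ b < n ] ∑[ a < n ] ⟦ Q b a ⟧        ≡⟨ sym (sum-cong-≗ (λ b → card≡∑ (Q b))) ⟩
  ∑[ b < n ] card (Q b)                 ∎
  where open ≡-Reasoning

orderedPairs-split : ∀ {n} (Q : PairPred n) →
                     orderedPairs Q ≡ countPairs Q + countPairs (flip Q) + card (λ a → Q a a)
orderedPairs-split {n} Q = begin
  ∑[ a < n ] card (Q a)
    ≡⟨ sum-cong-≗ (λ a → card-split-at a (Q a)) ⟩
  ∑[ a < n ] (card (above a) + card (below a) + ⟦ Q a a ⟧)
    ≡⟨ ∑-distrib-+ (λ a → card (above a) + card (below a)) (λ a → ⟦ Q a a ⟧) ⟩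
  ∑[ a < n ] (card (above a) + card (below a)) + ∑[ a < n ] ⟦ Q a a ⟧
    ≡⟨ cong₂ _+_ (∑-distrib-+ (card ∘ above) (card ∘ below)) (sym (card≡∑ (λ a → Q a a))) ⟩
  orderedPairs above + orderedPairs below + card (λ a → Q a a)
    ≡⟨ cong (λ m → m + card (λ a → Q a a))
            (sym (cong₂ _+_ (countPairs≡orderedPairs Q)
                            (trans (countPairs≡orderedPairs (flip Q)) (orderedPairs-flip below)))) ⟩
  countPairs Q + countPairs (flip Q) + card (λ a → Q a a) ∎
  where
  open ≡-Reasoning
  above below : PairPred n
  above a b = ⌊ a <? b ⌋ ∧ Q a b
  below a b = ⌊ b <? a ⌋ ∧ Q a b

countPairs-mono : ∀ {n} {Q R : PairPred n} → (∀ a b → Q a b ≡ true → R a b ≡ true) →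
                  countPairs Q ≤ countPairs R
countPairs-mono {Q = Q} {R} Q⊆R = begin
  countPairs Q                                  ≡⟨ countPairs≡orderedPairs Q ⟩
  orderedPairs (λ a b → ⌊ a <? b ⌋ ∧ Q a b)      ≤⟨ orderedPairs-mono restrict ⟩
  orderedPairs (λ a b → ⌊ a <? b ⌋ ∧ R a b)      ≡⟨ countPairs≡orderedPairs R ⟨
  countPairs R                                  ∎
  where
  open ≤-Reasoning
  restrict : ∀ a b → ⌊ a <? b ⌋ ∧ Q a b ≡ true → ⌊ a <? b ⌋ ∧ R a b ≡ true
  restrict a b h = cong₂ _∧_ (∧-conicalˡ _ _ h) (Q⊆R a b (∧-conicalʳ _ _ h))

countPairs-≤-orientations : ∀ {n} {Q : PairPred n} (A : PairPred n) →
                            (∀ a b → Q a b ≡ true → A a b ∨ A b a ≡ true) →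
                            countPairs Q ≤ countPairs A + countPairs (flip A)
countPairs-≤-orientations {Q = Q} A cover = begin
  countPairs Q
    ≤⟨ countPairs-mono cover ⟩
  countPairs (λ a b → A a b ∨ A b a)
    ≡⟨ countPairs≡orderedPairs (λ a b → A a b ∨ A b a) ⟩
  orderedPairs (λ a b → ⌊ a <? b ⌋ ∧ (A a b ∨ A b a))
    ≡⟨ sum-cong-≗ (λ a → card-cong (λ b → ∧-distribˡ-∨ ⌊ a <? b ⌋ (A a b) (A b a))) ⟩
  orderedPairs (λ a b → (⌊ a <? b ⌋ ∧ A a b) ∨ (⌊ a <? b ⌋ ∧ A b a))
    ≤⟨ orderedPairs-∨ (λ a b → ⌊ a <? b ⌋ ∧ A a b) (λ a b → ⌊ a <? b ⌋ ∧ A b a) ⟩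
  orderedPairs (λ a b → ⌊ a <? b ⌋ ∧ A a b) + orderedPairs (λ a b → ⌊ a <? b ⌋ ∧ A b a)
    ≡⟨ cong₂ _+_ (countPairs≡orderedPairs A) (countPairs≡orderedPairs (flip A)) ⟨
  countPairs A + countPairs (flip A) ∎
  where open ≤-Reasoning

-- Counting ordered pairs: |Q| + |s| ≤ |A| ≤ |s|² = 2 |P(s)| + |s|.
countPairs≤2*countPairs-Pset : ∀ {n} {Q : PairPred n} (A : PairPred n) (s : Subset n) →
                               (∀ a b → Q a b ≡ true → A a b ∨ A b a ≡ true) →
                               (∀ a → card (A a) ≤ card (Pset s a)) →
                               (∀ a → s a ≡ true → A a a ≡ true) →
                               countPairs Q ≤ 2 * countPairs (Pset s)
countPairs≤2*countPairs-Pset {Q = Q} A s cover rows diagonal = +-cancelʳ-≤ d _ _ (begin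
  countPairs Q + d
    ≤⟨ +-monoˡ-≤ d (countPairs-≤-orientations A cover) ⟩
  countPairs A + countPairs (flip A) + d
    ≡⟨ orderedPairs-split A ⟨
  orderedPairs A
    ≤⟨ ∑-mono-≤ rows ⟩
  orderedPairs P
    ≡⟨ orderedPairs-split P ⟩
  countPairs P + countPairs (flip P) + card (λ a → s a ∧ s a)
    ≤⟨ +-mono-≤ (+-monoʳ-≤ (countPairs P) (countPairs-mono (λ a b → trans (∧-comm (s a) (s b)))))
                (card-mono (λ a → diagonal a ∘ ∧-conicalˡ _ _)) ⟩
  countPairs P + countPairs P + d
    ≡⟨ cong (λ m → countPairs P + m + d) (+-identityʳ (countPairs P)) ⟨
  2 * countPairs P + d ∎)
  where
  open ≤-Reasoning
  P = Pset s
  d = card (λ a → A a a)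

PairwiseOn : ∀ {n} {A : Set} → (A → A → Bool) → (Fin n → A) → Subset n → Set
PairwiseOn R G B = ∀ x y → B x ≡ true → B y ≡ true → R (G x) (G y) ≡ true

_≟𝟙 : (s : Sym) → Dec (s ≡ 𝟙)
𝟘 ≟𝟙 = no λ ()
𝟙 ≟𝟙 = yes refl
N ≟𝟙 = no λ ()

resolvesSym-true : ∀ s → compatSym s 𝟙 ≡ true → resolvesSym true s ≡ true
resolvesSym-true 𝟙 _ = refl
resolvesSym-true N _ = refl

resolvesSym-false : ∀ s → s ≢ 𝟙 → resolvesSym false s ≡ true
resolvesSym-false 𝟘 _ = refl
resolvesSym-false 𝟙 s≢𝟙 = ⊥-elim (s≢𝟙 refl)
resolvesSym-false N _ = refl

-- The bit is 1 iff some member of B has a 1 here; by compatibility no member then has a 0.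
commonBit : ∀ {n} (σ : Fin n → Sym) (B : Subset n) → PairwiseOn compatSym σ B →
            ∃ λ bit → ∀ x → B x ≡ true → resolvesSym bit (σ x) ≡ true
commonBit σ B compat with any? (λ y → (B y ≟ᵇ true) ×-dec (σ y ≟𝟙))
... | yes (y , By , σy≡𝟙) =
  true , λ x Bx →
    resolvesSym-true (σ x) (subst (λ s → compatSym (σ x) s ≡ true) σy≡𝟙 (compat x y Bx By))
... | no noOne = false , λ x Bx → resolvesSym-false (σ x) (λ σx≡𝟙 → noOne (x , Bx , σx≡𝟙))

compatible-∷⁻ : ∀ {l} (v w : Fingerprint (suc l)) → compatible v w ≡ true →
                compatSym (head v) (head w) ≡ true × compatible (tail v) (tail w) ≡ true
compatible-∷⁻ (a ∷ v) (b ∷ w) h = ∧-conicalˡ _ _ h , ∧-conicalʳ _ _ h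

isResolution-∷⁺ : ∀ {l b} {r : Vec Bool l} (v : Fingerprint (suc l)) →
                  resolvesSym b (head v) ≡ true → isResolution r (tail v) ≡ true →
                  isResolution (b ∷ r) v ≡ true
isResolution-∷⁺ (a ∷ v) p q = cong₂ _∧_ p q

isResolution-[] : (v : Fingerprint 0) → isResolution [] v ≡ true
isResolution-[] [] = refl

commonResolution : ∀ {n l} (G : Fin n → Fingerprint l) (B : Subset n) → PairwiseOn compatible G B →
                   ∃ λ r → ∀ x → B x ≡ true → isResolution r (G x) ≡ true
commonResolution {l = zero}  G B _      = [] , λ x _ → isResolution-[] (G x)
commonResolution {l = suc l} G B compat =
  let bit , bitOK = commonBit (head ∘ G) B (λ x y Bx By → proj₁ (compat-∷⁻ x y Bx By))
      r   , rOK   = commonResolution (tail ∘ G) B (λ x y Bx By → proj₂ (compat-∷⁻ x y Bx By))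
  in  bit ∷ r , λ x Bx → isResolution-∷⁺ (G x) (bitOK x Bx) (rOK x Bx)
  where
  compat-∷⁻ : ∀ x y → B x ≡ true → B y ≡ true →
              compatSym (head (G x)) (head (G y)) ≡ true × compatible (tail (G x)) (tail (G y)) ≡ true
  compat-∷⁻ x y Bx By = compatible-∷⁻ (G x) (G y) (compat x y Bx By)

≡ᵇ≡true⇒≡ : ∀ m n → (m ≡ᵇ n) ≡ true → m ≡ n
≡ᵇ≡true⇒≡ m n h = ≡ᵇ⇒≡ m n (Equivalence.from T-≡ h)

≡ᵇ-refl : ∀ m → (m ≡ᵇ m) ≡ true
≡ᵇ-refl m = Equivalence.to T-≡ (≡⇒≡ᵇ m m refl)

≡ᵇ-sym : ∀ m n → (m ≡ᵇ n) ≡ true → (n ≡ᵇ m) ≡ true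
≡ᵇ-sym m n h = subst (λ k → (k ≡ᵇ m) ≡ true) (≡ᵇ≡true⇒≡ m n h) (≡ᵇ-refl m)

∨≡true⇒⊎ : ∀ x {y} → x ∨ y ≡ true → x ≡ true ⊎ y ≡ true
∨≡true⇒⊎ true  _ = inj₁ refl
∨≡true⇒⊎ false h = inj₂ h

module _ {n l : ℕ} (F : Fin n → Fingerprint l) where

  card-block≤card-hit : (U : Subset n) (r : Vec Bool l) →
                        (∀ r′ → InR F r′ → card (hit F U r′) ≤ card (hit F U r)) →
                        (B : Subset n) → PairwiseOn compatible F B → ∀ a → B a ≡ true →
                        card (λ b → U b ∧ B b) ≤ card (hit F U r)
  card-block≤card-hit U r maximal B compat a Ba =
    let r′ , resolves = commonResolution F B compat
    in  ≤-trans (card-mono (λ b h → cong₂ _∧_ (∧-conicalˡ _ _ h) (resolves b (∧-conicalʳ _ _ h))))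
                (maximal r′ (a , resolves a Ba))

  block-compatible : ∀ {c} → Feasible F c → ∀ a → PairwiseOn compatible F (PQ F c a)
  block-compatible {c} feasible a x y ax ay =
    feasible x y (trans (sym (≡ᵇ≡true⇒≡ (c a) (c x) ax)) (≡ᵇ≡true⇒≡ (c a) (c y) ay))

  record GreedyStage (U₀ : Subset n) (ss : List (Subset n)) (k : ℕ) : Set where
    field
      U         : Subset n
      r         : Vec Bool l
      maximal   : ∀ r′ → InR F r′ → card (hit F U r′) ≤ card (hit F U r)
      chosen    : seqAt ss k ≡ hit F U r
      uncovered : ∀ x → U₀ x ≡ true → (∀ j → j < k → seqAt ss j x ≡ false) → U x ≡ true

  greedyStage : ∀ {U₀ ss} → GreedyFrom F U₀ ss → (i : Fin (length ss)) → GreedyStage U₀ ss (toℕ i)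
  greedyStage {U₀} (step r _ _ maximal _) zero = record
    { U = U₀ ; r = r ; maximal = maximal ; chosen = refl ; uncovered = λ _ inU₀ _ → inU₀ }
  greedyStage {U₀} (step r _ _ _ rest) (suc i) = record
    { U = U ; r = r′ ; maximal = maximal ; chosen = chosen
    ; uncovered = λ x inU₀ fresh →
        uncovered x (cong₂ (λ p q → p ∧ not q) inU₀ (fresh 0 z<s)) (λ j → fresh (suc j) ∘ s<s) }
    where open GreedyStage (greedyStage rest i) renaming (r to r′)

module _ {n : ℕ} (c : Fin n → ℕ) (ss : List (Subset n)) where

  PQW⇒POptBefore : ∀ {j k} a b → j < k →
                   PQW c (seqAt ss j) a b ≡ true → POptBefore c ss k a b ≡ true
  PQW⇒POptBefore {j} {suc k} a b j<1+k h with m<1+n⇒m<n∨m≡n j<1+k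
  ... | inj₁ j<k  = cong (_∨ POpt c ss k a b) (PQW⇒POptBefore a b j<k h)
  ... | inj₂ refl = x∨[y∧¬x] (POptBefore c ss k a b) h
    where
    x∨[y∧¬x] : ∀ x {y} → y ≡ true → x ∨ (y ∧ not x) ≡ true
    x∨[y∧¬x] true  _    = refl
    x∨[y∧¬x] false refl = refl

  POpt⇒fresh : ∀ {k} a b → POpt c ss k a b ≡ true →
               ∀ j → j < k → seqAt ss j a ∨ seqAt ss j b ≡ false
  POpt⇒fresh {k} a b h j j<k =
    ¬-not (λ covered → not-¬ notBefore (PQW⇒POptBefore a b j<k (cong₂ _∧_ same covered)))
    where
    same = ∧-conicalˡ _ _ (∧-conicalˡ _ _ h)
    notBefore : POptBefore c ss k a b ≡ false
    notBefore = not-injective (∧-conicalʳ _ _ h)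

seqAt-lookup : ∀ {n} (ss : List (Subset n)) (i : Fin (length ss)) → seqAt ss (toℕ i) ≡ lookup ss i
seqAt-lookup (s ∷ ss) zero    = refl
seqAt-lookup (s ∷ ss) (suc i) = seqAt-lookup ss i

module _ {n l : ℕ} (F : Fin n → Fingerprint l) {c : Fin n → ℕ} (feasible : Feasible F c)
         {ss : List (Subset n)} {k : ℕ} (stage : GreedyStage F (λ _ → true) ss k) where

  open GreedyStage stage

  greedyStage-bound : countPairs (POpt c ss k) ≤ 2 * countPairs (Pset (seqAt ss k))
  greedyStage-bound = countPairs≤2*countPairs-Pset witness s POpt⇒witness rows diagonal
    where
    s = seqAt ss k

    s⊆U : ∀ x → s x ≡ true → U x ≡ true
    s⊆U x sx = ∧-conicalˡ _ _ (trans (sym (cong (λ t → t x) chosen)) sx)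

    witness : PairPred n
    witness a b = s a ∧ (U b ∧ PQ F c a b)

    POpt⇒witness : ∀ a b → POpt c ss k a b ≡ true → witness a b ∨ witness b a ≡ true
    POpt⇒witness a b h = [ left , right ]′ (∨≡true⇒⊎ (s a) (∧-conicalʳ _ _ inPQW))
      where
      inPQW : PQW c s a b ≡ true
      inPQW = ∧-conicalˡ _ _ h
      same : PQ F c a b ≡ true
      same = ∧-conicalˡ _ _ inPQW
      fresh = POpt⇒fresh c ss a b h
      Ua = uncovered a refl (λ j j<k → ∨-conicalˡ _ _ (fresh j j<k))
      Ub = uncovered b refl (λ j j<k → ∨-conicalʳ _ _ (fresh j j<k))

      left : s a ≡ true → witness a b ∨ witness b a ≡ true
      left sa = cong (_∨ witness b a) (cong₂ _∧_ sa (cong₂ _∧_ Ub same))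

      right : s b ≡ true → witness a b ∨ witness b a ≡ true
      right sb = trans (cong (witness a b ∨_) (cong₂ _∧_ sb (cong₂ _∧_ Ua (≡ᵇ-sym (c a) (c b) same))))
                       (∨-zeroʳ (witness a b))

    rows : ∀ a → card (witness a) ≤ card (Pset s a)
    rows a = card-∧ˡ-mono (s a) {λ b → U b ∧ PQ F c a b} {s} λ _ →
      ≤-trans (card-block≤card-hit F U r maximal (PQ F c a) (block-compatible F feasible a)
                                   a (≡ᵇ-refl (c a)))
              (≤-reflexive (cong card (sym chosen)))

    diagonal : ∀ a → s a ≡ true → witness a a ≡ true
    diagonal a sa = cong₂ _∧_ sa (cong₂ _∧_ (s⊆U a sa) (≡ᵇ-refl (c a)))

lemma3p1 : (p n l : ℕ) (F : Fin n → Fingerprint l) →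
             Injective _≡_ _≡_ F →
             (∀ x → countN (F x) ≤ p) →
             (ss : List (Subset n)) → GreedyRun F ss →
             (c : Fin n → ℕ) → Optimal F c →
             (i : Fin (length ss)) →
             countPairs (POpt c ss (toℕ i)) ≤ 2 * countPairs (Pset (lookup ss i))
lemma3p1 p n l F _ _ ss greedy c (feasible , _) i =
  subst (λ s → countPairs (POpt c ss (toℕ i)) ≤ 2 * countPairs (Pset s)) (seqAt-lookup ss i)
        (greedyStage-bound F feasible (greedyStage F greedy i))
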